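{- Let $k\geq 1$. For any $n\geq k$, $$p_{n;\leq n-k}=p_{n;\leq n-k+1}-\sum_{i=1}^{k}\binom{n}{i}p_{n-i;\leq n-k}$$ and $$p_{n;\leq n-k}=(n+1)^{n-1}-\sum_{i=1}^{k}\binom{n}{i}(k-i+1)(k+1)^{i-1}p_{n-i;\leq n-k}.$$
   Context: There are $n$ parking spaces in a line numbered $1,\dots,n$; $n$ cars arrive in order, car $j$ has preference $a_j\in[n]$ and parks in the first unoccupied space numbered $\geq a_j$, if any; $(a_1,\dots,a_n)$ is a parking function if all cars park. For $1\le s\le n$, $p_{n;\leq s}$ is the number of parking functions of length $n$ with all $a_j\leq s$; by convention $p_{0;\leq 0}=1$ and $p_{n;\leq 0}=0$ for $n>0$. -}

module Defs where

open import Data.Nat using (ℕ; zero; suc; _≤_; _≤?_; _∸_; _+_; _*_; _^_)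
open import Data.Bool using (Bool; true; false; _∧_)
open import Data.Fin using (Fin; toℕ) renaming (zero to fzero; suc to fsuc)
open import Data.Vec using (Vec; []; _∷_)
open import Data.List using (List; []; _∷_; map; concatMap; length; filter; allFin)
open import Data.Maybe using (Maybe; just; nothing)
open import Relation.Nullary.Decidable using (⌊_⌋)
open import Relation.Binary.PropositionalEquality using (_≡_)

-- Parking spaces 1..m are represented by Fin m (index i stands for space i+1).
-- An occupancy state is a Vec Bool m (true = occupied).

park : {m : ℕ} → Vec Bool m → Fin m → Maybe (Vec Bool m)
park (false ∷ occ) fzero = just (true ∷ occ)
park (true ∷ occ) fzero with occ
... | [] = nothing
... | o ∷ os with park (o ∷ os) fzero
...   | just occ' = just (true ∷ occ')
...   | nothing = nothing
park (b ∷ occ) (fsuc a) with park occ a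
... | just occ' = just (b ∷ occ')
... | nothing = nothing

allPark : {m : ℕ} → Vec Bool m → {k : ℕ} → Vec (Fin m) k → Bool
allPark occ [] = true
allPark occ (a ∷ as) with park occ a
... | just occ' = allPark occ' as
... | nothing = false

emptyLot : (m : ℕ) → Vec Bool m
emptyLot zero = []
emptyLot (suc m) = false ∷ emptyLot m

isParkingFunction : {n : ℕ} → Vec (Fin n) n → Bool
isParkingFunction {n} a = allPark (emptyLot n) a

allVecs : (m k : ℕ) → List (Vec (Fin m) k)
allVecs m zero = [] ∷ []
allVecs m (suc k) = concatMap (λ i → map (i ∷_) (allVecs m k)) (allFin m)

-- all entries (1-indexed preferences toℕ aⱼ + 1) are ≤ s
allLeq : {m k : ℕ} → ℕ → Vec (Fin m) k → Bool
allLeq s [] = true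
allLeq s (a ∷ as) = ⌊ suc (toℕ a) ≤? s ⌋ ∧ allLeq s as

-- p_{n;≤s}: number of parking functions of length n with all aⱼ ≤ s
-- (gives p_{0;≤0} = 1 and p_{n;≤0} = 0 for n > 0 automatically)
pLeq : ℕ → ℕ → ℕ
pLeq n s = length (filter (λ a → (allLeq s a ∧ isParkingFunction a) Data.Bool.≟ true) (allVecs n n))

open import Data.Integer using (ℤ; +_) renaming (_+_ to _+ℤ_)
sumFrom1 : ℕ → (ℕ → ℤ) → ℤ
sumFrom1 zero f = + 0
sumFrom1 (suc k) f = sumFrom1 k f +ℤ f (suc k)

module Submission where

-- Index spaces and preferences from 0 and put s = n - k.  A preference word of
-- length n is a parking function iff, for every t, at most n - t letters are ≥ t
-- (allPark-criterion).  Splitting a word into its letters < s and its i letters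
-- ≥ s factorises this criterion (SplitAt): the small part must be a parking
-- function of length n - i with values < s, and the large part, shifted down by
-- s, must let i cars park on k spaces.  Summing over the C(n,i) interleavings
-- (Shuffle) counts the parking functions with letters in [0,s) ∪ B as
--     Σ_{i ≤ k} C(n,i) · p_{n-i;≤s} · #{admissible large parts of size i}.
-- For B = {s} every large part with i ≤ k is admissible: the first identity.
-- For B = [s,n) the left side counts all (n+1)^{n-1} parking functions and the
-- large parts number (k+1-i)(k+1)^{i-1}, the closed form of the parking-count
-- recurrence (via the binomial theorem): the second identity.  The identities
-- are proved in ℕ and transferred to ℤ at the end.

module ParkingCounts where

  open import Defs
  open import Data.Nat
  open import Data.Nat.Properties
  open import Data.Nat.Tactic.RingSolver using (solve-∀)
  open import Data.Nat.Combinatorics using (_C_; nCk+nC[k+1]≡[n+1]C[k+1])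
  open import Data.Bool using (Bool; true; false; not; _∧_; T)
  open import Data.Bool.Properties using (T-∧)
  open import Data.Unit using (tt)
  open import Data.Empty using (⊥-elim)
  open import Data.Fin using (Fin; toℕ) renaming (zero to fzero; suc to fsuc)
  open import Data.Fin.Properties using (toℕ<n)
  open import Data.Vec using (Vec; []; _∷_)
  open import Data.List using (List; []; _∷_; _++_; map; length; replicate; filter; tabulate; allFin; concatMap)
  open import Data.List.Properties using (map-tabulate; length-replicate; filter-accept; filter-reject)
  open import Data.List.Relation.Unary.All as All using (All; []; _∷_)
  open import Data.List.Relation.Unary.All.Properties using (replicate⁺; all-filter)
  open import Data.Maybe using (Maybe; just; nothing)
  open import Data.Product using (_×_; _,_; proj₁; proj₂)
  open import Data.Sum using (inj₁; inj₂)
  open import Function using (_∘_; id; Equivalence)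
  open import Relation.Nullary using (¬_; yes; no)
  open import Relation.Nullary.Decidable using (⌊_⌋)
  open import Relation.Binary.PropositionalEquality

  Σ< : ℕ → (ℕ → ℕ) → ℕ
  Σ< zero f = 0
  Σ< (suc n) f = Σ< n f + f n

  Σ<-cong : ∀ n {f g : ℕ → ℕ} → (∀ i → i < n → f i ≡ g i) → Σ< n f ≡ Σ< n g
  Σ<-cong zero eq = refl
  Σ<-cong (suc n) eq = cong₂ _+_ (Σ<-cong n (λ i i<n → eq i (m<n⇒m<1+n i<n))) (eq n ≤-refl)

  Σ<-+ : ∀ n (f g : ℕ → ℕ) → Σ< n (λ i → f i + g i) ≡ Σ< n f + Σ< n g
  Σ<-+ zero f g = refl
  Σ<-+ (suc n) f g = begin
    Σ< n (λ i → f i + g i) + (f n + g n) ≡⟨ cong (_+ (f n + g n)) (Σ<-+ n f g) ⟩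
    Σ< n f + Σ< n g + (f n + g n)        ≡⟨ +-exchange (Σ< n f) (Σ< n g) (f n) (g n) ⟩
    Σ< n f + f n + (Σ< n g + g n)        ∎
    where
    open ≡-Reasoning
    +-exchange : ∀ a b c d → a + b + (c + d) ≡ a + c + (b + d)
    +-exchange = solve-∀

  Σ<-*ˡ : ∀ n c (f : ℕ → ℕ) → Σ< n (λ i → c * f i) ≡ c * Σ< n f
  Σ<-*ˡ zero c f = sym (*-zeroʳ c)
  Σ<-*ˡ (suc n) c f = trans (cong (_+ c * f n) (Σ<-*ˡ n c f)) (sym (*-distribˡ-+ c (Σ< n f) (f n)))

  Σ<-head : ∀ n (f : ℕ → ℕ) → Σ< (suc n) f ≡ f 0 + Σ< n (f ∘ suc)
  Σ<-head zero f = +-comm 0 (f 0)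
  Σ<-head (suc n) f = trans (cong (_+ f (suc n)) (Σ<-head n f)) (+-assoc (f 0) _ _)

  Σ<-truncate : ∀ a b f → a ≤ b → (∀ i → a ≤ i → i < b → f i ≡ 0) → Σ< b f ≡ Σ< a f
  Σ<-truncate a zero f z≤n _ = refl
  Σ<-truncate a (suc b) f a≤1+b vanish with m≤n⇒m<n∨m≡n a≤1+b
  ... | inj₂ refl = refl
  ... | inj₁ (s≤s a≤b) = begin
    Σ< b f + f b ≡⟨ cong₂ _+_ (Σ<-truncate a b f a≤b (λ i a≤i i<b → vanish i a≤i (m<n⇒m<1+n i<b)))
                              (vanish b a≤b ≤-refl) ⟩
    Σ< a f + 0   ≡⟨ +-identityʳ _ ⟩
    Σ< a f       ∎
    where open ≡-Reasoning

  binom : ℕ → ℕ → ℕ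
  binom n zero = 1
  binom zero (suc k) = 0
  binom (suc n) (suc k) = binom n k + binom n (suc k)

  binom≡C : ∀ n k → binom n k ≡ n C k
  binom≡C n zero = refl
  binom≡C zero (suc k) = refl
  binom≡C (suc n) (suc k) = trans (cong₂ _+_ (binom≡C n k) (binom≡C n (suc k))) (nCk+nC[k+1]≡[n+1]C[k+1] n k)

  binom-> : ∀ n k → n < k → binom n k ≡ 0
  binom-> zero (suc k) _ = refl
  binom-> (suc n) (suc k) (s≤s n<k) = cong₂ _+_ (binom-> n k n<k) (binom-> n (suc k) (m<n⇒m<1+n n<k))

  pascal-Σ : ∀ c (g : ℕ → ℕ) →
    Σ< (suc (suc c)) (λ i → binom (suc c) i * g i) ≡
    Σ< (suc c) (λ i → binom c i * g i) + Σ< (suc c) (λ i → binom c i * g (suc i))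
  pascal-Σ c g = begin
    Σ< (suc (suc c)) (λ i → binom (suc c) i * g i)
      ≡⟨ Σ<-head (suc c) _ ⟩
    1 * g 0 + Σ< (suc c) (λ i → (binom c i + binom c (suc i)) * g (suc i))
      ≡⟨ cong (1 * g 0 +_) (trans (Σ<-cong (suc c) (λ i _ → *-distribʳ-+ (g (suc i)) (binom c i) (binom c (suc i))))
                                  (Σ<-+ (suc c) _ _)) ⟩
    1 * g 0 + (A + (B + binom c (suc c) * g (suc c)))
      ≡⟨ cong (λ z → 1 * g 0 + (A + (B + z * g (suc c)))) (binom-> c (suc c) ≤-refl) ⟩
    1 * g 0 + (A + (B + 0 * g (suc c)))
      ≡⟨ rearrange (g 0) A B (g (suc c)) ⟩
    (1 * g 0 + B) + A
      ≡⟨ cong (_+ A) (sym (Σ<-head c (λ i → binom c i * g i))) ⟩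
    Σ< (suc c) (λ i → binom c i * g i) + A ∎
    where
    open ≡-Reasoning
    A : ℕ
    A = Σ< (suc c) (λ i → binom c i * g (suc i))
    B : ℕ
    B = Σ< c (λ i → binom c (suc i) * g (suc i))
    rearrange : ∀ a b d e → 1 * a + (b + (d + 0 * e)) ≡ (1 * a + d) + b
    rearrange = solve-∀

  binomial-theorem : ∀ c x → Σ< (suc c) (λ i → binom c i * x ^ i) ≡ suc x ^ c
  binomial-theorem zero x = refl
  binomial-theorem (suc c) x = begin
    Σ< (suc (suc c)) (λ i → binom (suc c) i * x ^ i)
      ≡⟨ pascal-Σ c (x ^_) ⟩
    S + Σ< (suc c) (λ i → binom c i * (x * x ^ i))
      ≡⟨ cong (S +_) (trans (Σ<-cong (suc c) (λ i _ → swap (binom c i) x (x ^ i))) (Σ<-*ˡ (suc c) x _)) ⟩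
    S + x * S
      ≡⟨ cong (λ z → z + x * z) (binomial-theorem c x) ⟩
    suc x ^ suc c ∎
    where
    open ≡-Reasoning
    S : ℕ
    S = Σ< (suc c) (λ i → binom c i * x ^ i)
    swap : ∀ a b d → a * (b * d) ≡ b * (a * d)
    swap = solve-∀

  -- Its derivative, multiplied by 1+x: (Σ_i C(c,i) i x^i)(1+x) = c x (1+x)^c.
  binomial-derivative : ∀ c x → Σ< (suc c) (λ i → binom c i * (i * x ^ i)) * suc x ≡ c * x * suc x ^ c
  binomial-derivative zero x = refl
  binomial-derivative (suc c) x = begin
    Σ< (suc (suc c)) (λ i → binom (suc c) i * (i * x ^ i)) * suc x
      ≡⟨ cong (_* suc x) (pascal-Σ c (λ i → i * x ^ i)) ⟩
    (D + Σ< (suc c) (λ i → binom c i * (suc i * (x * x ^ i)))) * suc x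
      ≡⟨ cong (λ z → (D + z) * suc x) shifted ⟩
    (D + (x * S + x * D)) * suc x
      ≡⟨ regroup D x S ⟩
    D * suc x * suc x + x * (S * suc x)
      ≡⟨ cong₂ (λ a b → a * suc x + x * (b * suc x)) (binomial-derivative c x) (binomial-theorem c x) ⟩
    c * x * suc x ^ c * suc x + x * (suc x ^ c * suc x)
      ≡⟨ collect c x (suc x ^ c) ⟩
    suc c * x * (suc x * suc x ^ c) ∎
    where
    open ≡-Reasoning
    S : ℕ
    S = Σ< (suc c) (λ i → binom c i * x ^ i)
    D : ℕ
    D = Σ< (suc c) (λ i → binom c i * (i * x ^ i))
    split : ∀ b i x p → b * (suc i * (x * p)) ≡ x * (b * p) + x * (b * (i * p))
    split = solve-∀
    regroup : ∀ d x s → (d + (x * s + x * d)) * suc x ≡ d * suc x * suc x + x * (s * suc x)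
    regroup = solve-∀
    collect : ∀ c x p → c * x * p * suc x + x * (p * suc x) ≡ suc c * x * (suc x * p)
    collect = solve-∀
    shifted : Σ< (suc c) (λ i → binom c i * (suc i * (x * x ^ i))) ≡ x * S + x * D
    shifted = begin
      Σ< (suc c) (λ i → binom c i * (suc i * (x * x ^ i)))
        ≡⟨ Σ<-cong (suc c) (λ i _ → split (binom c i) i x (x ^ i)) ⟩
      Σ< (suc c) (λ i → x * (binom c i * x ^ i) + x * (binom c i * (i * x ^ i)))
        ≡⟨ Σ<-+ (suc c) _ _ ⟩
      Σ< (suc c) (λ i → x * (binom c i * x ^ i)) + Σ< (suc c) (λ i → x * (binom c i * (i * x ^ i)))
        ≡⟨ cong₂ _+_ (Σ<-*ˡ (suc c) x _) (Σ<-*ˡ (suc c) x _) ⟩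
      x * S + x * D ∎

  -- The number H c m of ways c
  -- cars can all park on m spaces satisfies the three laws below (the third by
  -- splitting on the cars preferring the first space); any such H equals
  -- (m+1-c)(m+1)^{c-1}, which we state multiplied by m+1 to avoid c - 1.
  module ParkingCountClosedForm
    (H : ℕ → ℕ → ℕ)
    (H-no-cars : ∀ m → H 0 m ≡ 1)
    (H-too-many : ∀ c m → m < c → H c m ≡ 0)
    (H-recurrence : ∀ c m → c ≤ suc m → H c (suc m) ≡ Σ< (suc c) (λ i → binom c i * H i m))
    where

    -- The closed form at m, rescaled, also holds for c = m + 1 (both sides vanish).
    scaled-term : ∀ m i → i ≤ suc m → (∀ j → j ≤ m → H j m * suc m ≡ (suc m ∸ j) * suc m ^ j) →
                  suc m * H i m ≡ (suc m ∸ i) * suc m ^ i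
    scaled-term m i i≤1+m closed-m with m≤n⇒m<n∨m≡n i≤1+m
    ... | inj₁ (s≤s i≤m) = trans (*-comm (suc m) (H i m)) (closed-m i i≤m)
    ... | inj₂ refl = begin
      suc m * H (suc m) m ≡⟨ cong (suc m *_) (H-too-many (suc m) m ≤-refl) ⟩
      suc m * 0           ≡⟨ *-zeroʳ (suc m) ⟩
      0                   ≡⟨ cong (_* suc m ^ suc m) (sym (n∸n≡0 m)) ⟩
      (suc m ∸ suc m) * suc m ^ suc m ∎
      where open ≡-Reasoning

    closed-form : ∀ m c → c ≤ m → H c m * suc m ≡ (suc m ∸ c) * suc m ^ c
    closed-form zero zero _ = cong (_* 1) (H-no-cars 0)
    closed-form (suc m) c c≤1+m =
      *-cancelˡ-≡ _ _ M (+-cancelʳ-≡ (c * M * suc M ^ c) _ _ scaled)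
      where
      open ≡-Reasoning
      M : ℕ
      M = suc m
      U : ℕ
      U = Σ< (suc c) (λ i → binom c i * ((M ∸ i) * M ^ i))
      V : ℕ
      V = Σ< (suc c) (λ i → binom c i * (i * M ^ i))
      recurrence-scaled : H c M * M ≡ U
      recurrence-scaled = begin
        H c M * M                                     ≡⟨ *-comm _ M ⟩
        M * H c M                                     ≡⟨ cong (M *_) (H-recurrence c m c≤1+m) ⟩
        M * Σ< (suc c) (λ i → binom c i * H i m)      ≡⟨ sym (Σ<-*ˡ (suc c) M _) ⟩
        Σ< (suc c) (λ i → M * (binom c i * H i m))
          ≡⟨ Σ<-cong (suc c) (λ i i≤c → trans (swap M (binom c i) (H i m))
                (cong (binom c i *_) (scaled-term m i (≤-trans (≤-pred i≤c) c≤1+m) (closed-form m)))) ⟩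
        U ∎
        where
        swap : ∀ a b d → a * (b * d) ≡ b * (a * d)
        swap = solve-∀
      U+V : U + V ≡ M * suc M ^ c
      U+V = begin
        U + V ≡⟨ sym (Σ<-+ (suc c) _ _) ⟩
        Σ< (suc c) (λ i → binom c i * ((M ∸ i) * M ^ i) + binom c i * (i * M ^ i))
          ≡⟨ Σ<-cong (suc c) (λ i i≤c → trans (factor (binom c i) (M ∸ i) i (M ^ i))
                (cong (_* (binom c i * M ^ i)) (m∸n+n≡m (≤-trans (≤-pred i≤c) c≤1+m)))) ⟩
        Σ< (suc c) (λ i → M * (binom c i * M ^ i)) ≡⟨ Σ<-*ˡ (suc c) M _ ⟩
        M * Σ< (suc c) (λ i → binom c i * M ^ i)   ≡⟨ cong (M *_) (binomial-theorem c M) ⟩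
        M * suc M ^ c ∎
        where
        factor : ∀ b a i p → b * (a * p) + b * (i * p) ≡ (a + i) * (b * p)
        factor = solve-∀
      -- multiplying by M + 1, the derivative identity turns V into c M (M+1)^c
      scaled : M * (H c M * suc M) + c * M * suc M ^ c ≡ M * ((suc M ∸ c) * suc M ^ c) + c * M * suc M ^ c
      scaled = begin
        M * (H c M * suc M) + c * M * suc M ^ c
          ≡⟨ cong₂ _+_ (trans (sym (*-assoc M (H c M) (suc M))) (cong (_* suc M) (trans (*-comm M (H c M)) recurrence-scaled)))
                       (sym (binomial-derivative c M)) ⟩
        U * suc M + V * suc M                   ≡⟨ sym (*-distribʳ-+ (suc M) U V) ⟩
        (U + V) * suc M                         ≡⟨ cong (_* suc M) U+V ⟩
        M * suc M ^ c * suc M                   ≡⟨ cong (M * suc M ^ c *_) (sym (m∸n+n≡m (m≤n⇒m≤1+n c≤1+m))) ⟩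
        M * suc M ^ c * (suc M ∸ c + c)         ≡⟨ distribute M (suc M ^ c) (suc M ∸ c) c ⟩
        M * ((suc M ∸ c) * suc M ^ c) + c * M * suc M ^ c ∎
        where
        distribute : ∀ a p d c → a * p * (d + c) ≡ a * (d * p) + c * a * p
        distribute = solve-∀

  T-ext : ∀ {a b : Bool} → (T a → T b) → (T b → T a) → a ≡ b
  T-ext {false} {false} _ _ = refl
  T-ext {false} {true} _ b⇒a = ⊥-elim (b⇒a tt)
  T-ext {true} {false} a⇒b _ = ⊥-elim (a⇒b tt)
  T-ext {true} {true} _ _ = refl

  χ : Bool → ℕ
  χ true = 1
  χ false = 0

  χ-∧ : ∀ a b → χ (a ∧ b) ≡ χ a * χ b
  χ-∧ true b = sym (+-identityʳ (χ b))
  χ-∧ false b = refl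

  χ-true : ∀ {b} → T b → χ b ≡ 1
  χ-true {true} _ = refl

  χ-false : ∀ {b} → ¬ T b → χ b ≡ 0
  χ-false {false} _ = refl
  χ-false {true} ¬b = ⊥-elim (¬b tt)

  χ-≤ᵇ-yes : ∀ {t x} → t ≤ x → χ (t ≤ᵇ x) ≡ 1
  χ-≤ᵇ-yes t≤x = χ-true (≤⇒≤ᵇ t≤x)

  χ-≤ᵇ-no : ∀ {t x} → x < t → χ (t ≤ᵇ x) ≡ 0
  χ-≤ᵇ-no {t} {x} x<t = χ-false (λ t≤ᵇx → <⇒≱ x<t (≤ᵇ⇒≤ t x t≤ᵇx))

  Bounded : ℕ → (ℕ → ℕ) → (ℕ → ℕ) → Bool
  Bounded zero f g = f 0 ≤ᵇ g 0
  Bounded (suc m) f g = Bounded m f g ∧ (f (suc m) ≤ᵇ g (suc m))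

  bounded-intro : ∀ m {f g} → (∀ t → t ≤ m → f t ≤ g t) → T (Bounded m f g)
  bounded-intro zero f≤g = ≤⇒≤ᵇ (f≤g 0 z≤n)
  bounded-intro (suc m) f≤g = Equivalence.from T-∧
    (bounded-intro m (λ t t≤m → f≤g t (m≤n⇒m≤1+n t≤m)) , ≤⇒≤ᵇ (f≤g (suc m) ≤-refl))

  bounded-elim : ∀ m {f g} → T (Bounded m f g) → ∀ t → t ≤ m → f t ≤ g t
  bounded-elim zero {f} {g} b .zero z≤n = ≤ᵇ⇒≤ (f 0) (g 0) b
  bounded-elim (suc m) {f} {g} b t t≤1+m with Equivalence.to T-∧ b | m≤n⇒m<n∨m≡n t≤1+m
  ... | below , _ | inj₁ (s≤s t≤m) = bounded-elim m below t t≤m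
  ... | _ , top   | inj₂ refl = ≤ᵇ⇒≤ (f (suc m)) (g (suc m)) top

  bounded-ext : ∀ m m' {f g f' g'} →
    ((∀ t → t ≤ m → f t ≤ g t) → ∀ t → t ≤ m' → f' t ≤ g' t) →
    ((∀ t → t ≤ m' → f' t ≤ g' t) → ∀ t → t ≤ m → f t ≤ g t) →
    Bounded m f g ≡ Bounded m' f' g'
  bounded-ext m m' ⇒ ⇐ = T-ext (λ b → bounded-intro m' (⇒ (bounded-elim m b)))
                               (λ b → bounded-intro m (⇐ (bounded-elim m' b)))

  bounded-cong : ∀ m {f g f' g'} → (∀ t → f t ≡ f' t) → (∀ t → g t ≡ g' t) → Bounded m f g ≡ Bounded m f' g'
  bounded-cong zero f≡ g≡ = cong₂ _≤ᵇ_ (f≡ 0) (g≡ 0)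
  bounded-cong (suc m) f≡ g≡ = cong₂ _∧_ (bounded-cong m f≡ g≡) (cong₂ _≤ᵇ_ (f≡ (suc m)) (g≡ (suc m)))

  sumOver : {X : Set} → List X → (X → ℕ) → ℕ
  sumOver [] g = 0
  sumOver (x ∷ xs) g = g x + sumOver xs g

  sumOver-cong : {X : Set} {P : X → Set} (xs : List X) {g h : X → ℕ} →
                 All P xs → (∀ x → P x → g x ≡ h x) → sumOver xs g ≡ sumOver xs h
  sumOver-cong [] [] eq = refl
  sumOver-cong (x ∷ xs) (px ∷ pxs) eq = cong₂ _+_ (eq x px) (sumOver-cong xs pxs eq)

  sumOver-ext : {X : Set} (xs : List X) {g h : X → ℕ} → (∀ x → g x ≡ h x) → sumOver xs g ≡ sumOver xs h
  sumOver-ext [] eq = refl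
  sumOver-ext (x ∷ xs) eq = cong₂ _+_ (eq x) (sumOver-ext xs eq)

  sumOver-++ : {X : Set} (xs ys : List X) (g : X → ℕ) → sumOver (xs ++ ys) g ≡ sumOver xs g + sumOver ys g
  sumOver-++ [] ys g = refl
  sumOver-++ (x ∷ xs) ys g = trans (cong (g x +_) (sumOver-++ xs ys g)) (sym (+-assoc (g x) _ _))

  sumOver-*ˡ : {X : Set} (xs : List X) (c : ℕ) (g : X → ℕ) → sumOver xs (λ x → c * g x) ≡ c * sumOver xs g
  sumOver-*ˡ [] c g = sym (*-zeroʳ c)
  sumOver-*ˡ (x ∷ xs) c g = trans (cong (c * g x +_) (sumOver-*ˡ xs c g)) (sym (*-distribˡ-+ c _ _))

  sumOver-+ : {X : Set} (xs : List X) (f g : X → ℕ) → sumOver xs (λ x → f x + g x) ≡ sumOver xs f + sumOver xs g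
  sumOver-+ [] f g = refl
  sumOver-+ (x ∷ xs) f g = trans (cong (f x + g x +_) (sumOver-+ xs f g)) (+-exchange (f x) (g x) _ _)
    where
    +-exchange : ∀ a b c d → a + b + (c + d) ≡ a + c + (b + d)
    +-exchange = solve-∀

  sumOver-0 : {X : Set} (xs : List X) → sumOver xs (λ _ → 0) ≡ 0
  sumOver-0 xs = sumOver-*ˡ xs 0 (λ _ → 0)

  sumOver-map : {X Y : Set} (h : X → Y) (xs : List X) (g : Y → ℕ) → sumOver (map h xs) g ≡ sumOver xs (g ∘ h)
  sumOver-map h [] g = refl
  sumOver-map h (x ∷ xs) g = cong (g (h x) +_) (sumOver-map h xs g)

  sumOver-concatMap : {X Y : Set} (F : X → List Y) (xs : List X) (g : Y → ℕ) →
                      sumOver (concatMap F xs) g ≡ sumOver xs (λ x → sumOver (F x) g)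
  sumOver-concatMap F [] g = refl
  sumOver-concatMap F (x ∷ xs) g = trans (sumOver-++ (F x) _ g) (cong (sumOver (F x) g +_) (sumOver-concatMap F xs g))

  sumOver-swap : {X Y : Set} (xs : List X) (ys : List Y) (g : X → Y → ℕ) →
                 sumOver xs (λ x → sumOver ys (g x)) ≡ sumOver ys (λ y → sumOver xs (λ x → g x y))
  sumOver-swap [] ys g = sym (sumOver-0 ys)
  sumOver-swap (x ∷ xs) ys g = trans (cong (sumOver ys (g x) +_) (sumOver-swap xs ys g)) (sym (sumOver-+ ys (g x) _))

  sumOver-Σ< : {X : Set} (xs : List X) (n : ℕ) (g : X → ℕ → ℕ) →
               sumOver xs (λ x → Σ< n (g x)) ≡ Σ< n (λ i → sumOver xs (λ x → g x i))
  sumOver-Σ< [] n g = sym (Σ<-*ˡ n 0 (λ _ → 0))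
  sumOver-Σ< (x ∷ xs) n g = trans (cong (Σ< n (g x) +_) (sumOver-Σ< xs n g)) (sym (Σ<-+ n (g x) _))

  length-filter-χ : {X : Set} (B : X → Bool) (xs : List X) →
    length (filter (λ x → B x Data.Bool.≟ true) xs) ≡ sumOver xs (χ ∘ B)
  length-filter-χ B [] = refl
  length-filter-χ B (x ∷ xs) with B x
  ... | true = cong suc (length-filter-χ B xs)
  ... | false = length-filter-χ B xs

  sumWords : List ℕ → ℕ → (List ℕ → ℕ) → ℕ
  sumWords A zero f = f []
  sumWords A (suc c) f = sumOver A (λ x → sumWords A c (λ w → f (x ∷ w)))

  sumWords-cong : ∀ {P : ℕ → Set} A c {f g : List ℕ → ℕ} → All P A →
    (∀ w → length w ≡ c → All P w → f w ≡ g w) → sumWords A c f ≡ sumWords A c g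
  sumWords-cong A zero PA eq = eq [] refl []
  sumWords-cong A (suc c) PA eq =
    sumOver-cong A PA (λ x px → sumWords-cong A c PA (λ w len Pw → eq (x ∷ w) (cong suc len) (px ∷ Pw)))

  sumWords-ext : ∀ A c {f g : List ℕ → ℕ} → (∀ w → f w ≡ g w) → sumWords A c f ≡ sumWords A c g
  sumWords-ext A zero eq = eq []
  sumWords-ext A (suc c) eq = sumOver-ext A (λ x → sumWords-ext A c (λ w → eq (x ∷ w)))

  sumWords-*ˡ : ∀ A c k f → sumWords A c (λ w → k * f w) ≡ k * sumWords A c f
  sumWords-*ˡ A zero k f = refl
  sumWords-*ˡ A (suc c) k f = trans (sumOver-ext A (λ x → sumWords-*ˡ A c k (λ w → f (x ∷ w)))) (sumOver-*ˡ A k _)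

  sumWords-*ʳ : ∀ A c k f → sumWords A c (λ w → f w * k) ≡ sumWords A c f * k
  sumWords-*ʳ A c k f = trans (sumWords-ext A c (λ w → *-comm (f w) k)) (trans (sumWords-*ˡ A c k f) (*-comm k _))

  sumWords-0 : ∀ A c → sumWords A c (λ _ → 0) ≡ 0
  sumWords-0 A c = sumWords-*ˡ A c 0 (λ _ → 0)

  sumWords-sumOver : ∀ A c B (g : List ℕ → ℕ → ℕ) →
    sumWords A c (λ w → sumOver B (g w)) ≡ sumOver B (λ y → sumWords A c (λ w → g w y))
  sumWords-sumOver A zero B g = refl
  sumWords-sumOver A (suc c) B g =
    trans (sumOver-ext A (λ x → sumWords-sumOver A c B (λ w → g (x ∷ w)))) (sumOver-swap A B _)

  sumWords-single : ∀ x c f → sumWords (x ∷ []) c f ≡ f (replicate c x)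
  sumWords-single x zero f = refl
  sumWords-single x (suc c) f = trans (+-identityʳ _) (sumWords-single x c (λ w → f (x ∷ w)))

  sumWords-map : ∀ h A c f → sumWords (map h A) c f ≡ sumWords A c (λ w → f (map h w))
  sumWords-map h A zero f = refl
  sumWords-map h A (suc c) f =
    trans (sumOver-map h A _) (sumOver-ext A (λ x → sumWords-map h A c (λ w → f (h x ∷ w))))

  small large : ℕ → List ℕ → List ℕ
  small s = filter (_<? s)
  large s = filter (s ≤?_)

  -- If the letters of A are below s and those of B at least s,
  -- a word over A ++ B with i large letters is an interleaving (one of C(c,i))
  -- of a word over A of length c - i and a word over B of length i.
  module Shuffle (s : ℕ) (A B : List ℕ) (A<s : All (_< s) A) (s≤B : All (s ≤_) B) where

    sumPairs : (List ℕ → List ℕ → ℕ) → ℕ → ℕ → ℕ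
    sumPairs R a b = sumWords A a (λ S → sumWords B b (λ L → R S L))

    shuffle : ∀ c (R : List ℕ → List ℕ → ℕ) →
      sumWords (A ++ B) c (λ w → R (small s w) (large s w)) ≡ Σ< (suc c) (λ i → binom c i * sumPairs R (c ∸ i) i)
    shuffle zero R = sym (+-identityʳ _)
    shuffle (suc c) R = begin
      sumOver (A ++ B) (λ x → sumWords (A ++ B) c (λ w → R (small s (x ∷ w)) (large s (x ∷ w))))
        ≡⟨ sumOver-++ A B _ ⟩
      sumOver A (λ x → sumWords (A ++ B) c (λ w → R (small s (x ∷ w)) (large s (x ∷ w)))) +
      sumOver B (λ x → sumWords (A ++ B) c (λ w → R (small s (x ∷ w)) (large s (x ∷ w))))
        ≡⟨ cong₂ _+_ (sumOver-cong A A<s smallFirst) (sumOver-cong B s≤B largeFirst) ⟩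
      sumOver A (λ x → Σ< (suc c) (λ i → binom c i * sumPairs (λ S L → R (x ∷ S) L) (c ∸ i) i)) +
      sumOver B (λ y → Σ< (suc c) (λ i → binom c i * sumPairs (λ S L → R S (y ∷ L)) (c ∸ i) i))
        ≡⟨ cong₂ _+_ (trans (sumOver-Σ< A (suc c) _) (Σ<-cong (suc c) (λ i _ → sumOver-*ˡ A (binom c i) _)))
                     (trans (sumOver-Σ< B (suc c) _) (Σ<-cong (suc c) (λ i _ →
                       trans (sumOver-*ˡ B (binom c i) _) (cong (binom c i *_) (sym (sumWords-sumOver A (c ∸ i) B _)))))) ⟩
      Σ< (suc c) (λ i → binom c i * sumPairs R (suc (c ∸ i)) i) + Σ< (suc c) (λ i → binom c i * sumPairs R (c ∸ i) (suc i))
        ≡⟨ cong (_+ Σ< (suc c) (λ i → binom c i * sumPairs R (c ∸ i) (suc i)))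
                (Σ<-cong (suc c) (λ i i≤c → cong (λ z → binom c i * sumPairs R z i) (sym (+-∸-assoc 1 (≤-pred i≤c))))) ⟩
      Σ< (suc c) (λ i → binom c i * sumPairs R (suc c ∸ i) i) + Σ< (suc c) (λ i → binom c i * sumPairs R (c ∸ i) (suc i))
        ≡⟨ sym (pascal-Σ c (λ i → sumPairs R (suc c ∸ i) i)) ⟩
      Σ< (suc (suc c)) (λ i → binom (suc c) i * sumPairs R (suc c ∸ i) i) ∎
      where
      open ≡-Reasoning
      smallFirst : ∀ x → x < s →
        sumWords (A ++ B) c (λ w → R (small s (x ∷ w)) (large s (x ∷ w))) ≡
        Σ< (suc c) (λ i → binom c i * sumPairs (λ S L → R (x ∷ S) L) (c ∸ i) i)
      smallFirst x x<s = trans (sumWords-ext (A ++ B) c (λ w →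
          cong₂ R (filter-accept (_<? s) x<s) (filter-reject (s ≤?_) (<⇒≱ x<s))))
        (shuffle c (λ S L → R (x ∷ S) L))
      largeFirst : ∀ y → s ≤ y →
        sumWords (A ++ B) c (λ w → R (small s (y ∷ w)) (large s (y ∷ w))) ≡
        Σ< (suc c) (λ i → binom c i * sumPairs (λ S L → R S (y ∷ L)) (c ∸ i) i)
      largeFirst y s≤y = trans (sumWords-ext (A ++ B) c (λ w →
          cong₂ R (filter-reject (_<? s) (≤⇒≯ s≤y)) (filter-accept (s ≤?_) s≤y)))
        (shuffle c (λ S L → R S (y ∷ L)))

  atLeast : ℕ → List ℕ → ℕ
  atLeast t [] = 0
  atLeast t (x ∷ w) = χ (t ≤ᵇ x) + atLeast t w

  atLeast-antitone : ∀ {t t'} w → t ≤ t' → atLeast t' w ≤ atLeast t w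
  atLeast-antitone [] t≤t' = z≤n
  atLeast-antitone {t} {t'} (x ∷ w) t≤t' = +-mono-≤ indicator (atLeast-antitone w t≤t')
    where
    indicator : χ (t' ≤ᵇ x) ≤ χ (t ≤ᵇ x)
    indicator with t' ≤? x
    ... | yes t'≤x = ≤-reflexive (trans (χ-≤ᵇ-yes t'≤x) (sym (χ-≤ᵇ-yes (≤-trans t≤t' t'≤x))))
    ... | no t'≰x = ≤-trans (≤-reflexive (χ-≤ᵇ-no (≰⇒> t'≰x))) z≤n

  atLeast-all : ∀ t w → All (t ≤_) w → atLeast t w ≡ length w
  atLeast-all t [] [] = refl
  atLeast-all t (x ∷ w) (t≤x ∷ t≤w) = cong₂ _+_ (χ-≤ᵇ-yes t≤x) (atLeast-all t w t≤w)

  atLeast-none : ∀ t w → All (_< t) w → atLeast t w ≡ 0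
  atLeast-none t [] [] = refl
  atLeast-none t (x ∷ w) (x<t ∷ w<t) = cong₂ _+_ (χ-≤ᵇ-no x<t) (atLeast-none t w w<t)

  atLeast-zero : ∀ w → atLeast 0 w ≡ length w
  atLeast-zero w = atLeast-all 0 w (All.universal (λ _ → z≤n) w)

  atLeast-shift : ∀ s t w → atLeast (s + t) (map (s +_) w) ≡ atLeast t w
  atLeast-shift s t [] = refl
  atLeast-shift s t (x ∷ w) = cong₂ _+_ shifted (atLeast-shift s t w)
    where
    shifted : χ (s + t ≤ᵇ s + x) ≡ χ (t ≤ᵇ x)
    shifted with t ≤? x
    ... | yes t≤x = trans (χ-≤ᵇ-yes (+-monoʳ-≤ s t≤x)) (sym (χ-≤ᵇ-yes t≤x))
    ... | no t≰x = trans (χ-≤ᵇ-no (+-monoʳ-< s (≰⇒> t≰x))) (sym (χ-≤ᵇ-no (≰⇒> t≰x)))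

  atLeast-split : ∀ s t w → atLeast t w ≡ atLeast t (small s w) + atLeast t (large s w)
  atLeast-split s t [] = refl
  atLeast-split s t (x ∷ w) with x <? s
  ... | yes x<s = begin
    χ (t ≤ᵇ x) + atLeast t w
      ≡⟨ cong (χ (t ≤ᵇ x) +_) (atLeast-split s t w) ⟩
    χ (t ≤ᵇ x) + (atLeast t (small s w) + atLeast t (large s w))
      ≡⟨ sym (+-assoc (χ (t ≤ᵇ x)) _ _) ⟩
    atLeast t (x ∷ small s w) + atLeast t (large s w)
      ≡⟨ sym (cong₂ (λ S L → atLeast t S + atLeast t L) (filter-accept (_<? s) x<s) (filter-reject (s ≤?_) (<⇒≱ x<s))) ⟩
    atLeast t (small s (x ∷ w)) + atLeast t (large s (x ∷ w)) ∎
    where open ≡-Reasoning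
  ... | no x≮s = begin
    χ (t ≤ᵇ x) + atLeast t w
      ≡⟨ cong (χ (t ≤ᵇ x) +_) (atLeast-split s t w) ⟩
    χ (t ≤ᵇ x) + (atLeast t (small s w) + atLeast t (large s w))
      ≡⟨ +-exchange (χ (t ≤ᵇ x)) (atLeast t (small s w)) _ ⟩
    atLeast t (small s w) + atLeast t (x ∷ large s w)
      ≡⟨ sym (cong₂ (λ S L → atLeast t S + atLeast t L) (filter-reject (_<? s) x≮s) (filter-accept (s ≤?_) (≮⇒≥ x≮s))) ⟩
    atLeast t (small s (x ∷ w)) + atLeast t (large s (x ∷ w)) ∎
    where
    open ≡-Reasoning
    +-exchange : ∀ a b c → a + (b + c) ≡ b + (a + c)
    +-exchange = solve-∀

  freeFrom : ∀ {m} → ℕ → Vec Bool m → ℕ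
  freeFrom t [] = 0
  freeFrom zero (b ∷ occ) = χ (not b) + freeFrom zero occ
  freeFrom (suc t) (b ∷ occ) = freeFrom t occ

  freeFrom-empty : ∀ n t → freeFrom t (emptyLot n) ≡ n ∸ t
  freeFrom-empty zero zero = refl
  freeFrom-empty zero (suc t) = refl
  freeFrom-empty (suc n) zero = cong suc (freeFrom-empty n zero)
  freeFrom-empty (suc n) (suc t) = freeFrom-empty n t

  -- The effect of a car preferring a that takes space p: the spaces a..p-1
  -- were occupied, so the free count is constant on [a,p], and it drops by
  -- one exactly at the thresholds t ≤ p.
  record Occupies {m} (occ occ' : Vec Bool m) (a p : ℕ) : Set where
    field
      a≤p : a ≤ p
      drops : ∀ t → t ≤ p → freeFrom t occ ≡ suc (freeFrom t occ')
      keeps : ∀ t → p < t → freeFrom t occ ≡ freeFrom t occ'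
      flat : ∀ t → a ≤ t → t ≤ p → freeFrom t occ ≡ freeFrom a occ

  data ParkStep {m} (occ : Vec Bool m) (a : Fin m) : Maybe (Vec Bool m) → Set where
    fails : freeFrom (toℕ a) occ ≡ 0 → ParkStep occ a nothing
    takes : ∀ {occ'} p → Occupies occ occ' (toℕ a) p → ParkStep occ a (just occ')

  drops-behind : ∀ {m} {occ occ' : Vec Bool m} {p} b → (∀ t → t ≤ p → freeFrom t occ ≡ suc (freeFrom t occ')) →
                 ∀ t → t ≤ suc p → freeFrom t (b ∷ occ) ≡ suc (freeFrom t (b ∷ occ'))
  drops-behind b drops zero _ = trans (cong (χ (not b) +_) (drops 0 z≤n)) (+-suc (χ (not b)) _)
  drops-behind b drops (suc t) t≤1+p = drops t (≤-pred t≤1+p)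

  keeps-behind : ∀ {m} {occ occ' : Vec Bool m} {p} b → (∀ t → p < t → freeFrom t occ ≡ freeFrom t occ') →
                 ∀ t → suc p < t → freeFrom t (b ∷ occ) ≡ freeFrom t (b ∷ occ')
  keeps-behind b keeps (suc t) p<t = keeps t (≤-pred p<t)

  occupies-behind : ∀ {m} {occ occ' : Vec Bool m} {a p} b → Occupies occ occ' a p →
                    Occupies (b ∷ occ) (b ∷ occ') (suc a) (suc p)
  occupies-behind {occ = occ} {a = a} {p} b step = record
    { a≤p = s≤s a≤p ; drops = drops-behind b drops ; keeps = keeps-behind b keeps ; flat = flat' }
    where
    open Occupies step
    flat' : ∀ t → suc a ≤ t → t ≤ suc p → freeFrom t (b ∷ occ) ≡ freeFrom (suc a) (b ∷ occ)
    flat' (suc t) a<t t≤1+p = flat t (≤-pred a<t) (≤-pred t≤1+p)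

  parkStep : ∀ {m} (occ : Vec Bool m) (a : Fin m) → ParkStep occ a (park occ a)
  parkStep (false ∷ occ) fzero = takes 0 record { a≤p = z≤n ; drops = drops ; keeps = keeps ; flat = flat }
    where
    drops : ∀ t → t ≤ 0 → freeFrom t (false ∷ occ) ≡ suc (freeFrom t (true ∷ occ))
    drops .zero z≤n = refl
    keeps : ∀ t → 0 < t → freeFrom t (false ∷ occ) ≡ freeFrom t (true ∷ occ)
    keeps (suc t) _ = refl
    flat : ∀ t → 0 ≤ t → t ≤ 0 → freeFrom t (false ∷ occ) ≡ freeFrom 0 (false ∷ occ)
    flat .zero _ z≤n = refl
  parkStep (true ∷ []) fzero = fails refl
  parkStep (true ∷ o ∷ os) fzero with park (o ∷ os) fzero | parkStep (o ∷ os) fzero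
  ... | nothing | fails none = fails none
  ... | just _ | takes p step = takes (suc p) record
    { a≤p = z≤n ; drops = drops-behind true drops ; keeps = keeps-behind true keeps ; flat = flat' }
    where
    open Occupies step
    -- the first space is occupied, so the free count from 0 equals that from 1
    flat' : ∀ t → 0 ≤ t → t ≤ suc p → freeFrom t (true ∷ o ∷ os) ≡ freeFrom 0 (true ∷ o ∷ os)
    flat' zero _ _ = refl
    flat' (suc t) _ t≤1+p = flat t z≤n (≤-pred t≤1+p)
  parkStep (false ∷ occ) (fsuc a) with park occ a | parkStep occ a
  ... | nothing | fails none = fails none
  ... | just _ | takes p step = takes (suc p) (occupies-behind false step)
  parkStep (true ∷ occ) (fsuc a) with park occ a | parkStep occ a
  ... | nothing | fails none = fails none
  ... | just _ | takes p step = takes (suc p) (occupies-behind true step)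

  prefs : ∀ {m k} → Vec (Fin m) k → List ℕ
  prefs [] = []
  prefs (a ∷ as) = toℕ a ∷ prefs as

  ParkCriterion : ∀ {m} → Vec Bool m → List ℕ → Bool
  ParkCriterion {m} occ w = Bounded m (λ t → atLeast t w) (λ t → freeFrom t occ)

  module AfterOneCar {m} {occ occ' : Vec Bool m} {A p} (step : Occupies occ occ' A p) (A≤m : A ≤ m) (w : List ℕ) where
    open Occupies step

    forward : (∀ t → t ≤ m → atLeast t w ≤ freeFrom t occ') → ∀ t → t ≤ m → atLeast t (A ∷ w) ≤ freeFrom t occ
    forward after t t≤m with t ≤? A | t ≤? p
    ... | yes t≤A | _ = begin
      χ (t ≤ᵇ A) + atLeast t w ≡⟨ cong (_+ atLeast t w) (χ-≤ᵇ-yes t≤A) ⟩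
      suc (atLeast t w)        ≤⟨ s≤s (after t t≤m) ⟩
      suc (freeFrom t occ')    ≡⟨ sym (drops t (≤-trans t≤A a≤p)) ⟩
      freeFrom t occ           ∎
      where open ≤-Reasoning
    ... | no t≰A | yes t≤p = begin
      χ (t ≤ᵇ A) + atLeast t w ≡⟨ cong (_+ atLeast t w) (χ-≤ᵇ-no (≰⇒> t≰A)) ⟩
      atLeast t w              ≤⟨ m≤n⇒m≤1+n (after t t≤m) ⟩
      suc (freeFrom t occ')    ≡⟨ sym (drops t t≤p) ⟩
      freeFrom t occ           ∎
      where open ≤-Reasoning
    ... | no t≰A | no t≰p = begin
      χ (t ≤ᵇ A) + atLeast t w ≡⟨ cong (_+ atLeast t w) (χ-≤ᵇ-no (≰⇒> t≰A)) ⟩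
      atLeast t w              ≤⟨ after t t≤m ⟩
      freeFrom t occ'          ≡⟨ sym (keeps t (≰⇒> t≰p)) ⟩
      freeFrom t occ           ∎
      where open ≤-Reasoning

    backward : (∀ t → t ≤ m → atLeast t (A ∷ w) ≤ freeFrom t occ) → ∀ t → t ≤ m → atLeast t w ≤ freeFrom t occ'
    backward before t t≤m with t ≤? p | t ≤? A
    ... | yes t≤p | yes t≤A = ≤-pred (begin
      suc (atLeast t w)        ≡⟨ cong (_+ atLeast t w) (sym (χ-≤ᵇ-yes t≤A)) ⟩
      atLeast t (A ∷ w)        ≤⟨ before t t≤m ⟩
      freeFrom t occ           ≡⟨ drops t t≤p ⟩
      suc (freeFrom t occ')    ∎)
      where open ≤-Reasoning
    ... | yes t≤p | no t≰A = ≤-pred (begin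
      suc (atLeast t w)        ≤⟨ s≤s (atLeast-antitone w A≤t) ⟩
      suc (atLeast A w)        ≡⟨ cong (_+ atLeast A w) (sym (χ-≤ᵇ-yes (≤-refl {A}))) ⟩
      atLeast A (A ∷ w)        ≤⟨ before A A≤m ⟩
      freeFrom A occ           ≡⟨ sym (flat t A≤t t≤p) ⟩
      freeFrom t occ           ≡⟨ drops t t≤p ⟩
      suc (freeFrom t occ')    ∎)
      where
      open ≤-Reasoning
      A≤t : A ≤ t
      A≤t = <⇒≤ (≰⇒> t≰A)
    ... | no t≰p | _ = begin
      atLeast t w              ≤⟨ m≤n+m (atLeast t w) (χ (t ≤ᵇ A)) ⟩
      atLeast t (A ∷ w)        ≤⟨ before t t≤m ⟩
      freeFrom t occ           ≡⟨ keeps t (≰⇒> t≰p) ⟩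
      freeFrom t occ'          ∎
      where open ≤-Reasoning

  allPark-criterion : ∀ {m k} (occ : Vec Bool m) (as : Vec (Fin m) k) → allPark occ as ≡ ParkCriterion occ (prefs as)
  allPark-criterion {m} occ [] = sym (T-ext (λ _ → tt) (λ _ → bounded-intro m (λ t _ → z≤n)))
  allPark-criterion {m} occ (a ∷ as) with park occ a | parkStep occ a
  ... | nothing | fails none = T-ext (λ ()) (λ crit → ⊥-elim (1+n≰n (begin
      1                           ≤⟨ m≤m+n 1 (atLeast (toℕ a) (prefs as)) ⟩
      1 + atLeast (toℕ a) (prefs as) ≡⟨ cong (_+ atLeast (toℕ a) (prefs as)) (sym (χ-≤ᵇ-yes (≤-refl {toℕ a}))) ⟩
      atLeast (toℕ a) (prefs (a ∷ as)) ≤⟨ bounded-elim m crit (toℕ a) (<⇒≤ (toℕ<n a)) ⟩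
      freeFrom (toℕ a) occ        ≡⟨ none ⟩
      0                           ∎)))
    where open ≤-Reasoning
  ... | just occ' | takes p step = trans (allPark-criterion occ' as) (bounded-ext m m forward backward)
    where open AfterOneCar step (<⇒≤ (toℕ<n a)) (prefs as)

  ParksOn : ℕ → List ℕ → Bool
  ParksOn m w = Bounded m (λ t → atLeast t w) (m ∸_)

  isParkingFunction-criterion : ∀ n (a : Vec (Fin n) n) → isParkingFunction a ≡ ParksOn n (prefs a)
  isParkingFunction-criterion n a =
    trans (allPark-criterion (emptyLot n) a) (bounded-cong n (λ _ → refl) (freeFrom-empty n))

  range : ℕ → ℕ → List ℕ
  range lo zero = []
  range lo (suc k) = lo ∷ range (suc lo) k

  range-++ : ∀ lo a b → range lo (a + b) ≡ range lo a ++ range (lo + a) b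
  range-++ lo zero b = cong (λ z → range z b) (sym (+-identityʳ lo))
  range-++ lo (suc a) b = cong (lo ∷_) (trans (range-++ (suc lo) a b) (cong (λ z → range (suc lo) a ++ range z b) (sym (+-suc lo a))))

  range-bounds : ∀ lo k → All (λ x → lo ≤ x × x < lo + k) (range lo k)
  range-bounds lo zero = []
  range-bounds lo (suc k) = (≤-refl , lo<lo+1+k) ∷ All.map widen (range-bounds (suc lo) k)
    where
    widen : ∀ {x} → suc lo ≤ x × x < suc lo + k → lo ≤ x × x < lo + suc k
    widen {x} (lo<x , x<) = <⇒≤ lo<x , subst (x <_) (sym (+-suc lo k)) x<
    lo<lo+1+k : lo < lo + suc k
    lo<lo+1+k = subst (lo <_) (sym (+-suc lo k)) (s≤s (m≤m+n lo k))

  range-below : ∀ k → All (_< k) (range 0 k)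
  range-below k = All.map proj₂ (range-bounds 0 k)

  range-above : ∀ lo k → All (lo ≤_) (range lo k)
  range-above lo k = All.map proj₁ (range-bounds lo k)

  range-shift : ∀ lo k → range lo k ≡ map (lo +_) (range 0 k)
  range-shift lo k = trans (cong (λ z → range z k) (sym (+-identityʳ lo))) (shifted 0 k)
    where
    shifted : ∀ j k → range (lo + j) k ≡ map (lo +_) (range j k)
    shifted j zero = refl
    shifted j (suc k) = cong ((lo + j) ∷_) (trans (cong (λ z → range z k) (sym (+-suc lo j))) (shifted (suc j) k))

  tabulate-range : ∀ m lo (f : Fin m → ℕ) → (∀ i → f i ≡ lo + toℕ i) → tabulate f ≡ range lo m
  tabulate-range zero lo f eq = refl
  tabulate-range (suc m) lo f eq = cong₂ _∷_ (trans (eq fzero) (+-identityʳ lo))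
    (tabulate-range m (suc lo) (f ∘ fsuc) (λ i → trans (eq (fsuc i)) (+-suc lo (toℕ i))))

  sumOver-allVecs : ∀ m k (F : List ℕ → ℕ) → sumOver (allVecs m k) (F ∘ prefs) ≡ sumWords (range 0 m) k F
  sumOver-allVecs m zero F = +-identityʳ _
  sumOver-allVecs m (suc k) F = begin
    sumOver (concatMap (λ i → map (i ∷_) (allVecs m k)) (allFin m)) (F ∘ prefs)
      ≡⟨ sumOver-concatMap _ (allFin m) _ ⟩
    sumOver (allFin m) (λ i → sumOver (map (i ∷_) (allVecs m k)) (F ∘ prefs))
      ≡⟨ sumOver-ext (allFin m) (λ i → trans (sumOver-map (i ∷_) (allVecs m k) _) (sumOver-allVecs m k (λ w → F (toℕ i ∷ w)))) ⟩
    sumOver (allFin m) (λ i → sumWords (range 0 m) k (λ w → F (toℕ i ∷ w)))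
      ≡⟨ sym (sumOver-map toℕ (allFin m) _) ⟩
    sumOver (map toℕ (allFin m)) (λ x → sumWords (range 0 m) k (λ w → F (x ∷ w)))
      ≡⟨ cong (λ xs → sumOver xs (λ x → sumWords (range 0 m) k (λ w → F (x ∷ w))))
              (trans (map-tabulate id toℕ) (tabulate-range m 0 toℕ (λ _ → refl))) ⟩
    sumWords (range 0 m) (suc k) F ∎
    where open ≡-Reasoning

  allBelow : ℕ → List ℕ → Bool
  allBelow s [] = true
  allBelow s (x ∷ w) = ⌊ suc x ≤? s ⌋ ∧ allBelow s w

  allLeq-prefs : ∀ {m k} s (a : Vec (Fin m) k) → allLeq s a ≡ allBelow s (prefs a)
  allLeq-prefs s [] = refl
  allLeq-prefs s (x ∷ a) = cong (⌊ suc (toℕ x) ≤? s ⌋ ∧_) (allLeq-prefs s a)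

  pLeq-words : ∀ n s → pLeq n s ≡ sumWords (range 0 n) n (λ w → χ (allBelow s w ∧ ParksOn n w))
  pLeq-words n s = begin
    pLeq n s
      ≡⟨ length-filter-χ (λ a → allLeq s a ∧ isParkingFunction a) (allVecs n n) ⟩
    sumOver (allVecs n n) (λ a → χ (allLeq s a ∧ isParkingFunction a))
      ≡⟨ sumOver-ext (allVecs n n) (λ a → cong χ (cong₂ _∧_ (allLeq-prefs s a) (isParkingFunction-criterion n a))) ⟩
    sumOver (allVecs n n) (λ a → χ (allBelow s (prefs a) ∧ ParksOn n (prefs a)))
      ≡⟨ sumOver-allVecs n n _ ⟩
    sumWords (range 0 n) n (λ w → χ (allBelow s w ∧ ParksOn n w)) ∎
    where open ≡-Reasoning

  restrict-below : ∀ b A B → All (_< b) A → All (b ≤_) B → ∀ c (g : List ℕ → Bool) →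
    sumWords (A ++ B) c (λ w → χ (allBelow b w ∧ g w)) ≡ sumWords A c (χ ∘ g)
  restrict-below b A B A<b b≤B zero g = refl
  restrict-below b A B A<b b≤B (suc c) g = begin
    sumOver (A ++ B) (λ x → sumWords (A ++ B) c (λ w → χ (allBelow b (x ∷ w) ∧ g (x ∷ w))))
      ≡⟨ sumOver-++ A B _ ⟩
    sumOver A (λ x → sumWords (A ++ B) c (λ w → χ (allBelow b (x ∷ w) ∧ g (x ∷ w)))) +
    sumOver B (λ x → sumWords (A ++ B) c (λ w → χ (allBelow b (x ∷ w) ∧ g (x ∷ w))))
      ≡⟨ cong₂ _+_ (sumOver-cong A A<b kept) (sumOver-cong B b≤B dropped) ⟩
    sumOver A (λ x → sumWords A c (λ w → χ (g (x ∷ w)))) + sumOver B (λ _ → 0)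
      ≡⟨ cong (sumOver A (λ x → sumWords A c (λ w → χ (g (x ∷ w)))) +_) (sumOver-0 B) ⟩
    sumOver A (λ x → sumWords A c (λ w → χ (g (x ∷ w)))) + 0
      ≡⟨ +-identityʳ _ ⟩
    sumWords A (suc c) (χ ∘ g) ∎
    where
    open ≡-Reasoning
    below : ∀ {x} → x < b → ⌊ suc x ≤? b ⌋ ≡ true
    below {x} x<b with suc x ≤? b
    ... | yes _ = refl
    ... | no x≮b = ⊥-elim (x≮b x<b)
    notBelow : ∀ {x} → b ≤ x → ⌊ suc x ≤? b ⌋ ≡ false
    notBelow {x} b≤x with suc x ≤? b
    ... | yes x<b = ⊥-elim (<⇒≱ x<b b≤x)
    ... | no _ = refl
    kept : ∀ x → x < b → sumWords (A ++ B) c (λ w → χ (allBelow b (x ∷ w) ∧ g (x ∷ w))) ≡ sumWords A c (λ w → χ (g (x ∷ w)))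
    kept x x<b = trans (sumWords-ext (A ++ B) c (λ w → cong (λ z → χ ((z ∧ allBelow b w) ∧ g (x ∷ w))) (below x<b)))
                       (restrict-below b A B A<b b≤B c (λ w → g (x ∷ w)))
    dropped : ∀ x → b ≤ x → sumWords (A ++ B) c (λ w → χ (allBelow b (x ∷ w) ∧ g (x ∷ w))) ≡ 0
    dropped x b≤x = trans (sumWords-ext (A ++ B) c (λ w → cong (λ z → χ ((z ∧ allBelow b w) ∧ g (x ∷ w))) (notBelow b≤x)))
                          (sumWords-0 (A ++ B) c)

  parkCount : ℕ → ℕ → ℕ
  parkCount c m = sumWords (range 0 m) c (χ ∘ ParksOn m)

  parkCount-no-cars : ∀ m → parkCount 0 m ≡ 1
  parkCount-no-cars m = χ-true (bounded-intro m (λ t _ → z≤n))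

  parkCount-too-many : ∀ c m → m < c → parkCount c m ≡ 0
  parkCount-too-many c m m<c =
    trans (sumWords-cong (range 0 m) c (range-below m) (λ w len _ → χ-false (overfull w len))) (sumWords-0 (range 0 m) c)
    where
    overfull : ∀ w → length w ≡ c → ¬ T (ParksOn m w)
    overfull w len parks = <⇒≱ m<c (subst (_≤ m) (trans (atLeast-zero w) len) (bounded-elim m parks 0 z≤n))

  module SplitAt (s k : ℕ) where

    -- A small part S, together with i large letters, passes the thresholds t ≤ s.
    SmallOK : ℕ → List ℕ → Bool
    SmallOK i S = Bounded s (λ t → atLeast t S + i) ((s + k) ∸_)

    -- A large part L, shifted down by s, parks on the k large spaces.
    LargeOK : List ℕ → Bool
    LargeOK L = Bounded k (λ t → atLeast (s + t) L) (k ∸_)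

    criterion-split : ∀ S L → All (_< s) S → All (s ≤_) L →
      Bounded (s + k) (λ t → atLeast t S + atLeast t L) ((s + k) ∸_) ≡ (SmallOK (length L) S ∧ LargeOK L)
    criterion-split S L S<s s≤L =
      T-ext (λ whole → Equivalence.from T-∧ (bounded-intro s (toSmall (bounded-elim n whole)) ,
                                             bounded-intro k (toLarge (bounded-elim n whole))))
            (λ parts → bounded-intro n (combine (bounded-elim s (proj₁ (Equivalence.to T-∧ parts)))
                                                (bounded-elim k (proj₂ (Equivalence.to T-∧ parts)))))
      where
      n : ℕ
      n = s + k
      large-below : ∀ t → t ≤ s → atLeast t L ≡ length L
      large-below t t≤s = atLeast-all t L (All.map (≤-trans t≤s) s≤L)
      small-above : ∀ u → atLeast (s + u) S ≡ 0
      small-above u = atLeast-none (s + u) S (All.map (λ x<s → ≤-trans x<s (m≤m+n s u)) S<s)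
      Whole : Set
      Whole = ∀ t → t ≤ n → atLeast t S + atLeast t L ≤ n ∸ t
      toSmall : Whole → ∀ t → t ≤ s → atLeast t S + length L ≤ n ∸ t
      toSmall whole t t≤s = subst (λ z → atLeast t S + z ≤ n ∸ t) (large-below t t≤s) (whole t (≤-trans t≤s (m≤m+n s k)))
      toLarge : Whole → ∀ u → u ≤ k → atLeast (s + u) L ≤ k ∸ u
      toLarge whole u u≤k = subst₂ _≤_ (cong (_+ atLeast (s + u) L) (small-above u)) ([m+n]∸[m+o]≡n∸o s k u)
                                       (whole (s + u) (+-monoʳ-≤ s u≤k))
      combine : (∀ t → t ≤ s → atLeast t S + length L ≤ n ∸ t) → (∀ u → u ≤ k → atLeast (s + u) L ≤ k ∸ u) → Whole
      combine small large t t≤n with t ≤? s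
      ... | yes t≤s = subst (λ z → atLeast t S + z ≤ n ∸ t) (sym (large-below t t≤s)) (small t t≤s)
      ... | no t≰s = subst (λ t → atLeast t S + atLeast t L ≤ n ∸ t) (m+[n∸m]≡n s≤t) (shifted (t ∸ s) u≤k)
        where
        s≤t : s ≤ t
        s≤t = <⇒≤ (≰⇒> t≰s)
        u≤k : t ∸ s ≤ k
        u≤k = subst (t ∸ s ≤_) (m+n∸m≡n s k) (∸-monoˡ-≤ s t≤n)
        shifted : ∀ u → u ≤ k → atLeast (s + u) S + atLeast (s + u) L ≤ n ∸ (s + u)
        shifted u u≤k = subst₂ _≤_ (cong (_+ atLeast (s + u) L) (sym (small-above u))) (sym ([m+n]∸[m+o]≡n∸o s k u)) (large u u≤k)

    factorise : ∀ A B → All (_< s) A → All (s ≤_) B → ∀ c →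
      sumWords (A ++ B) c (χ ∘ ParksOn (s + k)) ≡
      Σ< (suc c) (λ i → binom c i * (sumWords A (c ∸ i) (χ ∘ SmallOK i) * sumWords B i (χ ∘ LargeOK)))
    factorise A B A<s s≤B c = begin
      sumWords (A ++ B) c (χ ∘ ParksOn (s + k))
        ≡⟨ sumWords-ext (A ++ B) c split-χ ⟩
      sumWords (A ++ B) c (λ w → R (small s w) (large s w))
        ≡⟨ Shuffle.shuffle s A B A<s s≤B c R ⟩
      Σ< (suc c) (λ i → binom c i * Shuffle.sumPairs s A B A<s s≤B R (c ∸ i) i)
        ≡⟨ Σ<-cong (suc c) (λ i _ → cong (binom c i *_) (separate i)) ⟩
      Σ< (suc c) (λ i → binom c i * (sumWords A (c ∸ i) (χ ∘ SmallOK i) * sumWords B i (χ ∘ LargeOK))) ∎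
      where
      open ≡-Reasoning
      R : List ℕ → List ℕ → ℕ
      R S L = χ (SmallOK (length L) S) * χ (LargeOK L)
      split-word : ∀ w → ParksOn (s + k) w ≡ (SmallOK (length (large s w)) (small s w) ∧ LargeOK (large s w))
      split-word w = trans (bounded-cong (s + k) (λ t → atLeast-split s t w) (λ _ → refl))
                           (criterion-split _ _ (all-filter (_<? s) w) (all-filter (s ≤?_) w))
      split-χ : ∀ w → χ (ParksOn (s + k) w) ≡ R (small s w) (large s w)
      split-χ w = trans (cong χ (split-word w)) (χ-∧ (SmallOK (length (large s w)) (small s w)) (LargeOK (large s w)))
      separate : ∀ i → sumWords A (c ∸ i) (λ S → sumWords B i (R S)) ≡
                       sumWords A (c ∸ i) (χ ∘ SmallOK i) * sumWords B i (χ ∘ LargeOK)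
      separate i = trans (sumWords-ext A (c ∸ i) (λ S →
          trans (sumWords-cong B i s≤B (λ L len _ → cong (λ j → χ (SmallOK j S) * χ (LargeOK L)) len))
                (sumWords-*ˡ B i (χ (SmallOK i S)) (χ ∘ LargeOK))))
        (sumWords-*ʳ A (c ∸ i) _ (χ ∘ SmallOK i))

    small-count : ∀ i → i ≤ k → sumWords (range 0 s) (s + k ∸ i) (χ ∘ SmallOK i) ≡ pLeq (s + k ∸ i) s
    small-count i i≤k = sym (begin
      pLeq L s
        ≡⟨ pLeq-words L s ⟩
      sumWords (range 0 L) L (λ w → χ (allBelow s w ∧ ParksOn L w))
        ≡⟨ cong (λ A → sumWords A L (λ w → χ (allBelow s w ∧ ParksOn L w))) (trans (cong (range 0) L≡s+[k-i]) (range-++ 0 s (k ∸ i))) ⟩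
      sumWords (range 0 s ++ range s (k ∸ i)) L (λ w → χ (allBelow s w ∧ ParksOn L w))
        ≡⟨ restrict-below s (range 0 s) (range s (k ∸ i)) (range-below s) (range-above s (k ∸ i)) L (ParksOn L) ⟩
      sumWords (range 0 s) L (χ ∘ ParksOn L)
        ≡⟨ sumWords-cong (range 0 s) L (range-below s) (λ S _ S<s → cong χ (same-criterion S S<s)) ⟩
      sumWords (range 0 s) L (χ ∘ SmallOK i) ∎)
      where
      open ≡-Reasoning
      L : ℕ
      L = s + k ∸ i
      L≡s+[k-i] : L ≡ s + (k ∸ i)
      L≡s+[k-i] = +-∸-assoc s i≤k
      s≤L : s ≤ L
      s≤L = subst (s ≤_) (sym L≡s+[k-i]) (m≤m+n s (k ∸ i))
      -- below L the bound n - t of the whole word is L - t plus the i large letters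
      bound : ∀ t → t ≤ L → s + k ∸ t ≡ (L ∸ t) + i
      bound t t≤L = trans (cong (_∸ t) (sym (m∸n+n≡m (≤-trans i≤k (m≤n+m k s))))) (+-∸-comm i t≤L)
      same-criterion : ∀ S → All (_< s) S → ParksOn L S ≡ SmallOK i S
      same-criterion S S<s = bounded-ext L s
        (λ parks t t≤s → subst (atLeast t S + i ≤_) (sym (bound t (≤-trans t≤s s≤L))) (+-monoˡ-≤ i (parks t (≤-trans t≤s s≤L))))
        restricted
        where
        restricted : (∀ t → t ≤ s → atLeast t S + i ≤ s + k ∸ t) → ∀ t → t ≤ L → atLeast t S ≤ L ∸ t
        restricted ok t t≤L with t ≤? s
        ... | yes t≤s = +-cancelʳ-≤ i _ _ (subst (atLeast t S + i ≤_) (bound t t≤L) (ok t t≤s))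
        ... | no t≰s = subst (_≤ L ∸ t) (sym (atLeast-none t S (All.map (λ x<s → <-≤-trans x<s (<⇒≤ (≰⇒> t≰s))) S<s))) z≤n

    -- More than k large letters never fit: the threshold s is violated.
    small-count-vanishes : ∀ i c → k < i → sumWords (range 0 s) c (χ ∘ SmallOK i) ≡ 0
    small-count-vanishes i c k<i =
      trans (sumWords-cong (range 0 s) c (range-below s) (λ S _ S<s → χ-false (violated S S<s))) (sumWords-0 (range 0 s) c)
      where
      violated : ∀ S → All (_< s) S → ¬ T (SmallOK i S)
      violated S S<s ok = <⇒≱ k<i (subst₂ _≤_ (cong (_+ i) (atLeast-none s S S<s)) (m+n∸m≡n s k) (bounded-elim s ok s ≤-refl))

    large-count-shift : ∀ i → sumWords (range s k) i (χ ∘ LargeOK) ≡ parkCount i k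
    large-count-shift i = begin
      sumWords (range s k) i (χ ∘ LargeOK)
        ≡⟨ cong (λ A → sumWords A i (χ ∘ LargeOK)) (range-shift s k) ⟩
      sumWords (map (s +_) (range 0 k)) i (χ ∘ LargeOK)
        ≡⟨ sumWords-map (s +_) (range 0 k) i _ ⟩
      sumWords (range 0 k) i (λ w → χ (LargeOK (map (s +_) w)))
        ≡⟨ sumWords-ext (range 0 k) i (λ w → cong χ (bounded-cong k (λ t → atLeast-shift s t w) (λ _ → refl))) ⟩
      parkCount i k ∎
      where open ≡-Reasoning

    large-count-single : ∀ i → i ≤ k → sumWords (s ∷ []) i (χ ∘ LargeOK) ≡ 1
    large-count-single i i≤k = trans (sumWords-single s i _) (χ-true (bounded-intro k fits))
      where
      fits : ∀ t → t ≤ k → atLeast (s + t) (replicate i s) ≤ k ∸ t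
      fits zero _ = subst (_≤ k) (sym (trans (atLeast-all (s + 0) _ (replicate⁺ i (≤-reflexive (+-identityʳ s)))) (length-replicate i))) i≤k
      fits (suc t) _ = subst (_≤ k ∸ suc t) (sym (atLeast-none (s + suc t) _ (replicate⁺ i (m<m+n s (s≤s z≤n))))) z≤n

  -- The recurrence for parkCount: split the m+1 spaces as 1 + m.  A word whose
  -- i large letters park on the last m spaces, with the remaining c - i cars
  -- preferring space 0, parks iff c ≤ m + 1 and i ≤ m.
  parkCount-recurrence : ∀ c m → c ≤ suc m → parkCount c (suc m) ≡ Σ< (suc c) (λ i → binom c i * parkCount i m)
  parkCount-recurrence c m c≤1+m =
    trans (factorise (0 ∷ []) (range 1 m) (s≤s z≤n ∷ []) (range-above 1 m) c)
          (Σ<-cong (suc c) (λ i i≤c → cong (binom c i *_) (term i (≤-pred i≤c))))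
    where
    open SplitAt 1 m
    term : ∀ i → i ≤ c → sumWords (0 ∷ []) (c ∸ i) (χ ∘ SmallOK i) * sumWords (range 1 m) i (χ ∘ LargeOK) ≡ parkCount i m
    term i i≤c with i ≤? m
    ... | yes i≤m = begin
      sumWords (0 ∷ []) (c ∸ i) (χ ∘ SmallOK i) * sumWords (range 1 m) i (χ ∘ LargeOK)
        ≡⟨ cong₂ _*_ (trans (sumWords-single 0 (c ∸ i) _) (χ-true (bounded-intro 1 fits))) (large-count-shift i) ⟩
      1 * parkCount i m ≡⟨ *-identityˡ _ ⟩
      parkCount i m ∎
      where
      open ≡-Reasoning
      zeros : List ℕ
      zeros = replicate (c ∸ i) 0
      fits : ∀ t → t ≤ 1 → atLeast t zeros + i ≤ suc m ∸ t
      fits zero _ = subst (_≤ suc m) (sym all-cars) c≤1+m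
        where
        all-cars : atLeast 0 zeros + i ≡ c
        all-cars = trans (cong (_+ i) (trans (atLeast-zero zeros) (length-replicate (c ∸ i)))) (m∸n+n≡m i≤c)
      fits (suc zero) _ = subst (_≤ m) (sym (cong (_+ i) (atLeast-none 1 zeros (replicate⁺ (c ∸ i) (s≤s z≤n))))) i≤m
      fits (suc (suc t)) (s≤s ())
    ... | no i≰m = trans (cong (smallPart *_) (trans (large-count-shift i) none)) (trans (*-zeroʳ smallPart) (sym none))
      where
      smallPart : ℕ
      smallPart = sumWords (0 ∷ []) (c ∸ i) (χ ∘ SmallOK i)
      none : parkCount i m ≡ 0
      none = parkCount-too-many i m (≰⇒> i≰m)

  open ParkingCountClosedForm parkCount parkCount-no-cars parkCount-too-many parkCount-recurrence

  parkCount-value : ∀ i k → 1 ≤ i → i ≤ k → parkCount i k ≡ suc (k ∸ i) * suc k ^ (i ∸ 1)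
  parkCount-value (suc j) k _ i≤k = *-cancelʳ-≡ _ _ (suc k) (begin
    parkCount (suc j) k * suc k            ≡⟨ closed-form k (suc j) i≤k ⟩
    (suc k ∸ suc j) * suc k ^ suc j        ≡⟨ cong (_* suc k ^ suc j) (+-∸-assoc 1 i≤k) ⟩
    suc (k ∸ suc j) * (suc k * suc k ^ j)  ≡⟨ reorder (suc (k ∸ suc j)) (suc k) (suc k ^ j) ⟩
    suc (k ∸ suc j) * suc k ^ j * suc k    ∎)
    where
    open ≡-Reasoning
    reorder : ∀ a b p → a * (b * p) ≡ a * p * b
    reorder = solve-∀

  parkCount-all : ∀ n → 1 ≤ n → parkCount n n ≡ suc n ^ (n ∸ 1)
  parkCount-all (suc j) _ = begin
    parkCount (suc j) (suc j)            ≡⟨ parkCount-value (suc j) (suc j) (s≤s z≤n) ≤-refl ⟩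
    suc (j ∸ j) * suc (suc j) ^ j        ≡⟨ cong (λ z → suc z * suc (suc j) ^ j) (n∸n≡0 j) ⟩
    1 * suc (suc j) ^ j                  ≡⟨ *-identityˡ _ ⟩
    suc (suc j) ^ j                      ∎
    where open ≡-Reasoning

  count-by-large-part : ∀ s k B → All (s ≤_) B →
    sumWords (range 0 s ++ B) (s + k) (χ ∘ ParksOn (s + k)) ≡
    Σ< (suc k) (λ i → binom (s + k) i * (pLeq (s + k ∸ i) s * sumWords B i (χ ∘ SplitAt.LargeOK s k)))
  count-by-large-part s k B s≤B = begin
    sumWords (range 0 s ++ B) n (χ ∘ ParksOn n)
      ≡⟨ factorise (range 0 s) B (range-below s) s≤B n ⟩
    Σ< (suc n) (λ i → binom n i * (smallCount i * largeCount i))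
      ≡⟨ Σ<-truncate (suc k) (suc n) _ (s≤s (m≤n+m k s)) (λ i k<i _ →
           trans (cong (λ z → binom n i * (z * largeCount i)) (small-count-vanishes i (n ∸ i) k<i)) (*-zeroʳ (binom n i))) ⟩
    Σ< (suc k) (λ i → binom n i * (smallCount i * largeCount i))
      ≡⟨ Σ<-cong (suc k) (λ i i≤k → cong (λ z → binom n i * (z * largeCount i)) (small-count i (≤-pred i≤k))) ⟩
    Σ< (suc k) (λ i → binom n i * (pLeq (n ∸ i) s * largeCount i)) ∎
    where
    open ≡-Reasoning
    open SplitAt s k
    n : ℕ
    n = s + k
    smallCount largeCount : ℕ → ℕ
    smallCount i = sumWords (range 0 s) (n ∸ i) (χ ∘ SmallOK i)
    largeCount i = sumWords B i (χ ∘ LargeOK)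

  first-identity : ∀ s k → 1 ≤ k → pLeq (s + k) (s + 1) ≡ Σ< (suc k) (λ i → binom (s + k) i * pLeq (s + k ∸ i) s)
  first-identity s k 1≤k = begin
    pLeq n (s + 1)
      ≡⟨ pLeq-words n (s + 1) ⟩
    sumWords (range 0 n) n (λ w → χ (allBelow (s + 1) w ∧ ParksOn n w))
      ≡⟨ cong (λ A → sumWords A n (λ w → χ (allBelow (s + 1) w ∧ ParksOn n w))) (trans (cong (range 0) n≡[s+1]+[k-1]) (range-++ 0 (s + 1) (k ∸ 1))) ⟩
    sumWords (range 0 (s + 1) ++ range (s + 1) (k ∸ 1)) n (λ w → χ (allBelow (s + 1) w ∧ ParksOn n w))
      ≡⟨ restrict-below (s + 1) (range 0 (s + 1)) _ (range-below (s + 1)) (range-above (s + 1) (k ∸ 1)) n (ParksOn n) ⟩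
    sumWords (range 0 (s + 1)) n (χ ∘ ParksOn n)
      ≡⟨ cong (λ A → sumWords A n (χ ∘ ParksOn n)) (range-++ 0 s 1) ⟩
    sumWords (range 0 s ++ (s ∷ [])) n (χ ∘ ParksOn n)
      ≡⟨ count-by-large-part s k (s ∷ []) (≤-refl ∷ []) ⟩
    Σ< (suc k) (λ i → binom n i * (pLeq (n ∸ i) s * sumWords (s ∷ []) i (χ ∘ SplitAt.LargeOK s k)))
      ≡⟨ Σ<-cong (suc k) (λ i i≤k → cong (λ z → binom n i * (pLeq (n ∸ i) s * z)) (SplitAt.large-count-single s k i (≤-pred i≤k))) ⟩
    Σ< (suc k) (λ i → binom n i * (pLeq (n ∸ i) s * 1))
      ≡⟨ Σ<-cong (suc k) (λ i _ → cong (binom n i *_) (*-identityʳ _)) ⟩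
    Σ< (suc k) (λ i → binom n i * pLeq (n ∸ i) s) ∎
    where
    open ≡-Reasoning
    n : ℕ
    n = s + k
    n≡[s+1]+[k-1] : n ≡ s + 1 + (k ∸ 1)
    n≡[s+1]+[k-1] = trans (cong (s +_) (sym (m+[n∸m]≡n 1≤k))) (sym (+-assoc s 1 (k ∸ 1)))

  second-identity : ∀ s k → 1 ≤ k →
    suc (s + k) ^ (s + k ∸ 1) ≡ Σ< (suc k) (λ i → binom (s + k) i * (pLeq (s + k ∸ i) s * parkCount i k))
  second-identity s k 1≤k = begin
    suc n ^ (n ∸ 1)
      ≡⟨ sym (parkCount-all n (≤-trans 1≤k (m≤n+m k s))) ⟩
    sumWords (range 0 n) n (χ ∘ ParksOn n)
      ≡⟨ cong (λ A → sumWords A n (χ ∘ ParksOn n)) (range-++ 0 s k) ⟩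
    sumWords (range 0 s ++ range s k) n (χ ∘ ParksOn n)
      ≡⟨ count-by-large-part s k (range s k) (range-above s k) ⟩
    Σ< (suc k) (λ i → binom n i * (pLeq (n ∸ i) s * sumWords (range s k) i (χ ∘ SplitAt.LargeOK s k)))
      ≡⟨ Σ<-cong (suc k) (λ i _ → cong (λ z → binom n i * (pLeq (n ∸ i) s * z)) (SplitAt.large-count-shift s k i)) ⟩
    Σ< (suc k) (λ i → binom n i * (pLeq (n ∸ i) s * parkCount i k)) ∎
    where
    open ≡-Reasoning
    n : ℕ
    n = s + k

open import Defs
open import Data.Nat using (ℕ; _≤_; _∸_; suc)
open import Data.Nat.Combinatorics using (_C_)
open import Data.Integer using (ℤ; +_; _-_; _*_; _^_)
open import Data.Product using (_×_; _,_)
open import Relation.Binary.PropositionalEquality using (_≡_; refl; sym; trans; cong; cong₂; module ≡-Reasoning)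
import Data.Nat as ℕ
import Data.Nat.Properties as ℕ
import Data.Nat.Tactic.RingSolver as ℕ-Solver
import Data.Integer.Properties as ℤ
import Data.Integer.Tactic.RingSolver as ℤ-Solver
open ParkingCounts using (Σ<; Σ<-head; binom; binom≡C; parkCount; parkCount-no-cars; parkCount-value; first-identity; second-identity)

+-^ : ∀ a m → + (a ℕ.^ m) ≡ (+ a) ^ m
+-^ a ℕ.zero = refl
+-^ a (suc m) = trans (ℤ.pos-* a (a ℕ.^ m)) (cong (+ a *_) (+-^ a m))

sumFrom1-+ : ∀ k (g : ℕ → ℤ) (h : ℕ → ℕ) → (∀ i → 1 ≤ i → i ≤ k → g i ≡ + h i) →
             sumFrom1 k g ≡ + Σ< k (λ i → h (suc i))
sumFrom1-+ ℕ.zero g h eq = refl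
sumFrom1-+ (suc k) g h eq = trans
  (cong₂ Data.Integer._+_ (sumFrom1-+ k g h (λ i 1≤i i≤k → eq i 1≤i (ℕ.m≤n⇒m≤1+n i≤k))) (eq (suc k) (ℕ.s≤s ℕ.z≤n) ℕ.≤-refl))
  (sym (ℤ.pos-+ (Σ< k (λ i → h (suc i))) (h (suc k))))

as-difference : ∀ a x y → x ≡ a ℕ.+ y → + a ≡ + x - + y
as-difference a x y x≡a+y = begin
  + a                            ≡⟨ add-sub (+ a) (+ y) ⟩
  (+ a Data.Integer.+ + y) - + y ≡⟨ cong (_- + y) (sym (trans (cong +_ x≡a+y) (ℤ.pos-+ a y))) ⟩
  + x - + y                      ∎
  where
  open ≡-Reasoning
  add-sub : ∀ (u v : ℤ) → u ≡ (u Data.Integer.+ v) - v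
  add-sub = ℤ-Solver.solve-∀

-- The two identities of the lemma, with s in place of n - k.
FirstRecurrence SecondRecurrence : ℕ → ℕ → ℕ → Set
FirstRecurrence k n s =
  + pLeq n s ≡ + pLeq n (s ℕ.+ 1) - sumFrom1 k (λ i → + (n C i) * + pLeq (n ∸ i) s)
SecondRecurrence k n s =
  + pLeq n s ≡ (+ suc n) ^ (n ∸ 1) - sumFrom1 k (λ i → + (n C i) * + suc (k ∸ i) * (+ suc k) ^ (i ∸ 1) * + pLeq (n ∸ i) s)

-- Both follow from the ℕ identities by splitting off the term i = 0.
recurrences : ∀ n s k → n ≡ s ℕ.+ k → 1 ≤ k → FirstRecurrence k n s × SecondRecurrence k n s
recurrences .(s ℕ.+ k) s k refl 1≤k = first , second
  where
  open ≡-Reasoning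
  n : ℕ
  n = s ℕ.+ k

  term₁ term₂ : ℕ → ℕ
  term₁ i = binom n i ℕ.* pLeq (n ∸ i) s
  term₂ i = binom n i ℕ.* (pLeq (n ∸ i) s ℕ.* parkCount i k)

  split₁ : pLeq n (s ℕ.+ 1) ≡ pLeq n s ℕ.+ Σ< k (λ i → term₁ (suc i))
  split₁ = trans (first-identity s k 1≤k)
                 (trans (Σ<-head k term₁) (cong (ℕ._+ Σ< k (λ i → term₁ (suc i))) (ℕ.+-identityʳ (pLeq n s))))

  split₂ : suc n ℕ.^ (n ∸ 1) ≡ pLeq n s ℕ.+ Σ< k (λ i → term₂ (suc i))
  split₂ = trans (second-identity s k 1≤k) (trans (Σ<-head k term₂) (cong (ℕ._+ Σ< k (λ i → term₂ (suc i))) zeroth))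
    where
    zeroth : term₂ 0 ≡ pLeq n s
    zeroth = trans (ℕ.*-identityˡ _) (trans (cong (pLeq n s ℕ.*_) (parkCount-no-cars k)) (ℕ.*-identityʳ _))

  embed₁ : ∀ i → 1 ≤ i → i ≤ k → + (n C i) * + pLeq (n ∸ i) s ≡ + term₁ i
  embed₁ i _ _ = trans (cong (λ c → + c * + pLeq (n ∸ i) s) (sym (binom≡C n i))) (sym (ℤ.pos-* (binom n i) _))

  embed₂ : ∀ i → 1 ≤ i → i ≤ k → + (n C i) * + suc (k ∸ i) * (+ suc k) ^ (i ∸ 1) * + pLeq (n ∸ i) s ≡ + term₂ i
  embed₂ i 1≤i i≤k = begin
    + (n C i) * + suc (k ∸ i) * (+ suc k) ^ (i ∸ 1) * + pLeq (n ∸ i) s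
      ≡⟨ cong (λ z → + (n C i) * + suc (k ∸ i) * z * + pLeq (n ∸ i) s) (sym (+-^ (suc k) (i ∸ 1))) ⟩
    + (n C i) * + suc (k ∸ i) * + (suc k ℕ.^ (i ∸ 1)) * + pLeq (n ∸ i) s
      ≡⟨ sym (pos-product (n C i) (suc (k ∸ i)) (suc k ℕ.^ (i ∸ 1)) (pLeq (n ∸ i) s)) ⟩
    + ((n C i) ℕ.* suc (k ∸ i) ℕ.* suc k ℕ.^ (i ∸ 1) ℕ.* pLeq (n ∸ i) s)
      ≡⟨ cong +_ (trans (reorder (n C i) (suc (k ∸ i)) (suc k ℕ.^ (i ∸ 1)) (pLeq (n ∸ i) s))
                        (cong₂ (λ c q → c ℕ.* (pLeq (n ∸ i) s ℕ.* q)) (sym (binom≡C n i)) (sym (parkCount-value i k 1≤i i≤k)))) ⟩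
    + term₂ i ∎
    where
    pos-product : ∀ a b c d → + (a ℕ.* b ℕ.* c ℕ.* d) ≡ + a * + b * + c * + d
    pos-product a b c d = trans (ℤ.pos-* (a ℕ.* b ℕ.* c) d) (cong (_* + d) (trans (ℤ.pos-* (a ℕ.* b) c) (cong (_* + c) (ℤ.pos-* a b))))
    reorder : ∀ c a r p → c ℕ.* a ℕ.* r ℕ.* p ≡ c ℕ.* (p ℕ.* (a ℕ.* r))
    reorder = ℕ-Solver.solve-∀

  first : FirstRecurrence k n s
  first = begin
    + pLeq n s
      ≡⟨ as-difference (pLeq n s) _ _ split₁ ⟩
    + pLeq n (s ℕ.+ 1) - + Σ< k (λ i → term₁ (suc i))
      ≡⟨ cong (+ pLeq n (s ℕ.+ 1) -_) (sym (sumFrom1-+ k _ term₁ embed₁)) ⟩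
    + pLeq n (s ℕ.+ 1) - sumFrom1 k (λ i → + (n C i) * + pLeq (n ∸ i) s) ∎

  second : SecondRecurrence k n s
  second = begin
    + pLeq n s
      ≡⟨ as-difference (pLeq n s) _ _ split₂ ⟩
    + (suc n ℕ.^ (n ∸ 1)) - + Σ< k (λ i → term₂ (suc i))
      ≡⟨ cong₂ _-_ (+-^ (suc n) (n ∸ 1)) (sym (sumFrom1-+ k _ term₂ embed₂)) ⟩
    (+ suc n) ^ (n ∸ 1) - sumFrom1 k (λ i → + (n C i) * + suc (k ∸ i) * (+ suc k) ^ (i ∸ 1) * + pLeq (n ∸ i) s) ∎

lemma2p7 : (k n : ℕ) → 1 ≤ k → k ≤ n →
    ((+ pLeq n (n ∸ k)) ≡ (+ pLeq n (n ∸ k Data.Nat.+ 1)) - sumFrom1 k (λ i → (+ (n C i)) * (+ pLeq (n ∸ i) (n ∸ k))))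
    × ((+ pLeq n (n ∸ k)) ≡ ((+ (suc n)) ^ (n ∸ 1)) - sumFrom1 k (λ i → (+ (n C i)) * (+ (suc (k ∸ i))) * ((+ (suc k)) ^ (i ∸ 1)) * (+ pLeq (n ∸ i) (n ∸ k))))
lemma2p7 k n 1≤k k≤n = recurrences n (n ∸ k) k (sym (ℕ.m∸n+n≡m k≤n)) 1≤k
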